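{- The following problems have a solution: $\mathrm{OP}^\ast(4,5)$, $\mathrm{OP}^\ast(4,6)$, $\mathrm{OP}^\ast(2,2,2,4)$, $\mathrm{OP}^\ast(4,8)$, and $\mathrm{OP}^\ast(2,4,6)$; $\mathrm{OP}^\ast(2^{\langle b\rangle},3,3)$ for $1\le b\le 5$; and $\mathrm{OP}^\ast(2^{\langle b\rangle},6)$ for $2\le b\le 4$.
   Context: $K_n^\ast$ is the complete symmetric digraph of order $n$. $\mathrm{OP}^\ast(m_1,\ldots,m_k)$ (with $n=m_1+\ldots+m_k$, all $m_i\ge 2$) asks for a decomposition of $K_n^\ast$ into spanning subdigraphs each a disjoint union of $k$ directed cycles of lengths $m_1,\ldots,m_k$ (a solution). $2^{\langle b\rangle}$ denotes $b$ copies of $2$. -}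

module Defs where

open import Data.Nat using (ℕ; zero; suc)
open import Data.Nat.DivMod using (_mod_)
open import Data.Nat.ListAction using (sum)
open import Data.Fin using (Fin; toℕ)
open import Data.List using (List; []; _∷_; length; lookup; replicate; _++_)
open import Data.Product using (Σ; ∃; _×_; _,_)
open import Relation.Binary.PropositionalEquality using (_≡_; _≢_)

next : ∀ {m} → Fin m → Fin m
next {suc m} j = suc (toℕ j) mod suc m

-- A spanning subdigraph of K_n^* (vertex set Fin n) that is a disjoint union
-- of directed cycles of lengths ms = (m_1,…,m_k).  Cycle i is given by its
-- vertex sequence cyc i : Fin m_i → Fin n (arcs cyc i j → cyc i (next j));
-- the cycles are pairwise vertex-disjoint, each has distinct vertices
-- (joint injectivity), and together they cover every vertex (spanning).
record CycleFactor (n : ℕ) (ms : List ℕ) : Set where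
  field
    cyc  : (i : Fin (length ms)) → Fin (lookup ms i) → Fin n
    inj  : ∀ i j i′ j′ → cyc i j ≡ cyc i′ j′ →
           _≡_ {A = Σ (Fin (length ms)) (λ i → Fin (lookup ms i))} (i , j) (i′ , j′)
    surj : ∀ v → ∃ λ i → ∃ λ j → cyc i j ≡ v

open CycleFactor public

Arc : ∀ {n ms} → CycleFactor n ms → Fin n → Fin n → Set
Arc F u v = ∃ λ i → ∃ λ j → cyc F i j ≡ u × cyc F i (next j) ≡ v

Decomposition : (n : ℕ) → List ℕ → Set
Decomposition n ms =
  Σ ℕ λ t → Σ (Fin t → CycleFactor n ms) λ F →
    ∀ u v → u ≢ v → ∃ λ s → Arc (F s) u v × (∀ s′ → Arc (F s′) u v → s′ ≡ s)

OPstar : List ℕ → Set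
OPstar ms = Decomposition (sum ms) ms

twos++ : ℕ → List ℕ → List ℕ
twos++ b ms = replicate b 2 ++ ms

-- Every instance is settled by an explicit solution, checked by a decision
-- procedure for the definition of a decomposition.  Most solutions are
-- 1-rotational: the vertices are ℤ_q ∪ {∞} with q = n − 1 and ∞ = q, and the
-- q factors are the translates x ↦ x + s (fixing ∞) of one base factor whose
-- arcs avoiding ∞ realise every nonzero difference of ℤ_q exactly once.  For
-- OP*(4,6) three base factors are translated by the subgroup 3ℤ_9 instead,
-- and the solution of OP*(4,8) is listed in full.

module Submission where

open import Defs
open import Data.Bool using (if_then_else_)
open import Data.Nat using (ℕ; zero; suc; NonZero; _+_; _*_; _≤_; s≤s; _<ᵇ_)
open import Data.Nat.DivMod using (_%_; _mod_)
open import Data.Nat.ListAction using (sum)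
open import Data.Fin using (Fin; toℕ)
open import Data.Fin.Properties using (_≟_; all?; any?)
open import Data.List using (List; []; _∷_; length; lookup; map; concatMap; applyUpTo)
open import Data.Product using (Σ; ∃; _×_; _,_)
open import Data.Product.Properties using (≡-dec)
open import Relation.Binary.Definitions using (DecidableEquality)
open import Relation.Binary.PropositionalEquality using (_≡_; _≢_)
open import Relation.Nullary using (Dec; ¬?)
open import Relation.Nullary.Decidable using (True; toWitness; _×-dec_; _→-dec_)

Cycles : ℕ → List ℕ → Set
Cycles n ms = (i : Fin (length ms)) → Fin (lookup ms i) → Fin n

Position : List ℕ → Set
Position ms = Σ (Fin (length ms)) (λ i → Fin (lookup ms i))

module _ {n : ℕ} {ms : List ℕ} where

  _≟ₚ_ : DecidableEquality (Position ms)
  _≟ₚ_ = ≡-dec _≟_ _≟_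

  IsInjective : Cycles n ms → Set
  IsInjective c = ∀ i j i′ j′ → c i j ≡ c i′ j′ → _≡_ {A = Position ms} (i , j) (i′ , j′)

  IsSpanning : Cycles n ms → Set
  IsSpanning c = ∀ v → ∃ λ i → ∃ λ j → c i j ≡ v

  ArcOf : Cycles n ms → Fin n → Fin n → Set
  ArcOf c u v = ∃ λ i → ∃ λ j → c i j ≡ u × c i (next j) ≡ v

  isInjective? : (c : Cycles n ms) → Dec (IsInjective c)
  isInjective? c = all? λ i → all? λ j → all? λ i′ → all? λ j′ →
    (c i j ≟ c i′ j′) →-dec ((i , j) ≟ₚ (i′ , j′))

  isSpanning? : (c : Cycles n ms) → Dec (IsSpanning c)
  isSpanning? c = all? λ v → any? λ i → any? λ j → c i j ≟ v

  arcOf? : (c : Cycles n ms) → ∀ u v → Dec (ArcOf c u v)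
  arcOf? c u v = any? λ i → any? λ j → (c i j ≟ u) ×-dec (c i (next j) ≟ v)

  CoversEachArcOnce : ∀ {t} → (Fin t → Cycles n ms) → Set
  CoversEachArcOnce C = ∀ u v → u ≢ v →
    ∃ λ s → ArcOf (C s) u v × (∀ s′ → ArcOf (C s′) u v → s′ ≡ s)

  coversEachArcOnce? : ∀ {t} (C : Fin t → Cycles n ms) → Dec (CoversEachArcOnce C)
  coversEachArcOnce? C = all? λ u → all? λ v → ¬? (u ≟ v) →-dec
    any? λ s → arcOf? (C s) u v ×-dec all? (λ s′ → arcOf? (C s′) u v →-dec (s′ ≟ s))

  IsDecomposition : ∀ {t} → (Fin t → Cycles n ms) → Set
  IsDecomposition C = (∀ s → IsInjective (C s)) × (∀ s → IsSpanning (C s)) × CoversEachArcOnce C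

  isDecomposition? : ∀ {t} (C : Fin t → Cycles n ms) → Dec (IsDecomposition C)
  isDecomposition? C =
    all? (λ s → isInjective? (C s)) ×-dec all? (λ s → isSpanning? (C s)) ×-dec coversEachArcOnce? C

  decomposition : ∀ {t} (C : Fin t → Cycles n ms) → IsDecomposition C → Decomposition n ms
  decomposition {t} C (inj , spanning , covers) = t , factor , covers
    where
    factor : Fin t → CycleFactor n ms
    factor s = record { cyc = C s ; inj = inj s ; surj = spanning s }

CycleList : Set
CycleList = List (List ℕ)

lookupOr : {A : Set} → A → List A → ℕ → A
lookupOr d []       _       = d
lookupOr d (x ∷ xs) zero    = x
lookupOr d (x ∷ xs) (suc k) = lookupOr d xs k

-- Entries are read modulo n and missing ones default to 0: ill-formed data
-- is simply rejected by the checker, which runs on the resulting Cycles.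
cyclesOf : ∀ n {{_ : NonZero n}} ms → CycleList → Cycles n ms
cyclesOf n ms cs i j = lookupOr 0 (lookupOr [] cs (toℕ i)) (toℕ j) mod n

translate : (q s : ℕ) {{_ : NonZero q}} → ℕ → ℕ
translate q s x = if x <ᵇ q then (x + s) % q else x

orbit : (q step k : ℕ) {{_ : NonZero q}} → CycleList → List CycleList
orbit q step k B = applyUpTo (λ s → map (map (translate q (s * step))) B) k

solution : ∀ ms {{_ : NonZero (sum ms)}} (fs : List CycleList) →
           True (isDecomposition? {sum ms} {ms} (λ s → cyclesOf (sum ms) ms (lookup fs s))) → OPstar ms
solution ms fs ok = decomposition _ (toWitness ok)

op⋆-4-5 : OPstar (4 ∷ 5 ∷ [])
op⋆-4-5 = solution (4 ∷ 5 ∷ []) (orbit 8 1 8 ((1 ∷ 5 ∷ 4 ∷ 7 ∷ []) ∷ (8 ∷ 2 ∷ 3 ∷ 0 ∷ 6 ∷ []) ∷ [])) _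

op⋆-4-6 : OPstar (4 ∷ 6 ∷ [])
op⋆-4-6 = solution (4 ∷ 6 ∷ []) (concatMap (orbit 9 3 3)
  ( ((0 ∷ 8 ∷ 7 ∷ 2 ∷ []) ∷ (1 ∷ 4 ∷ 9 ∷ 3 ∷ 5 ∷ 6 ∷ []) ∷ [])
  ∷ ((0 ∷ 7 ∷ 8 ∷ 5 ∷ []) ∷ (1 ∷ 3 ∷ 6 ∷ 2 ∷ 9 ∷ 4 ∷ []) ∷ [])
  ∷ ((0 ∷ 1 ∷ 8 ∷ 4 ∷ []) ∷ (2 ∷ 5 ∷ 7 ∷ 6 ∷ 3 ∷ 9 ∷ []) ∷ [])
  ∷ [])) _

op⋆-2-2-2-4 : OPstar (2 ∷ 2 ∷ 2 ∷ 4 ∷ [])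
op⋆-2-2-2-4 = solution (2 ∷ 2 ∷ 2 ∷ 4 ∷ []) (orbit 9 1 9 ((9 ∷ 5 ∷ []) ∷ (2 ∷ 1 ∷ []) ∷ (3 ∷ 8 ∷ []) ∷ (4 ∷ 7 ∷ 0 ∷ 6 ∷ []) ∷ [])) _

op⋆-4-8 : OPstar (4 ∷ 8 ∷ [])
op⋆-4-8 = solution (4 ∷ 8 ∷ [])
  ( ((0 ∷ 7 ∷ 5 ∷ 2 ∷ []) ∷ (1 ∷ 4 ∷ 10 ∷ 8 ∷ 3 ∷ 11 ∷ 9 ∷ 6 ∷ []) ∷ [])
  ∷ ((0 ∷ 9 ∷ 3 ∷ 5 ∷ []) ∷ (1 ∷ 11 ∷ 10 ∷ 4 ∷ 8 ∷ 6 ∷ 7 ∷ 2 ∷ []) ∷ [])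
  ∷ ((0 ∷ 8 ∷ 2 ∷ 6 ∷ []) ∷ (1 ∷ 10 ∷ 5 ∷ 4 ∷ 9 ∷ 11 ∷ 7 ∷ 3 ∷ []) ∷ [])
  ∷ ((0 ∷ 4 ∷ 2 ∷ 8 ∷ []) ∷ (1 ∷ 6 ∷ 10 ∷ 3 ∷ 7 ∷ 11 ∷ 5 ∷ 9 ∷ []) ∷ [])
  ∷ ((0 ∷ 6 ∷ 4 ∷ 11 ∷ []) ∷ (1 ∷ 8 ∷ 9 ∷ 5 ∷ 3 ∷ 2 ∷ 7 ∷ 10 ∷ []) ∷ [])
  ∷ ((0 ∷ 10 ∷ 11 ∷ 4 ∷ []) ∷ (1 ∷ 9 ∷ 7 ∷ 6 ∷ 2 ∷ 3 ∷ 8 ∷ 5 ∷ []) ∷ [])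
  ∷ ((0 ∷ 11 ∷ 2 ∷ 10 ∷ []) ∷ (1 ∷ 3 ∷ 6 ∷ 9 ∷ 4 ∷ 5 ∷ 8 ∷ 7 ∷ []) ∷ [])
  ∷ ((0 ∷ 5 ∷ 11 ∷ 3 ∷ []) ∷ (1 ∷ 2 ∷ 9 ∷ 10 ∷ 7 ∷ 4 ∷ 6 ∷ 8 ∷ []) ∷ [])
  ∷ ((0 ∷ 2 ∷ 4 ∷ 7 ∷ []) ∷ (1 ∷ 5 ∷ 10 ∷ 6 ∷ 3 ∷ 9 ∷ 8 ∷ 11 ∷ []) ∷ [])
  ∷ ((0 ∷ 1 ∷ 7 ∷ 9 ∷ []) ∷ (2 ∷ 5 ∷ 6 ∷ 11 ∷ 8 ∷ 4 ∷ 3 ∷ 10 ∷ []) ∷ [])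
  ∷ ((0 ∷ 3 ∷ 4 ∷ 1 ∷ []) ∷ (2 ∷ 11 ∷ 6 ∷ 5 ∷ 7 ∷ 8 ∷ 10 ∷ 9 ∷ []) ∷ [])
  ∷ []) _

op⋆-2-4-6 : OPstar (2 ∷ 4 ∷ 6 ∷ [])
op⋆-2-4-6 = solution (2 ∷ 4 ∷ 6 ∷ []) (orbit 11 1 11 ((11 ∷ 6 ∷ []) ∷ (4 ∷ 1 ∷ 7 ∷ 3 ∷ []) ∷ (0 ∷ 5 ∷ 9 ∷ 8 ∷ 10 ∷ 2 ∷ []) ∷ [])) _

op⋆-2^1-3-3 : OPstar (2 ∷ 3 ∷ 3 ∷ [])
op⋆-2^1-3-3 = solution (2 ∷ 3 ∷ 3 ∷ []) (orbit 7 1 7 ((7 ∷ 3 ∷ []) ∷ (1 ∷ 6 ∷ 2 ∷ []) ∷ (4 ∷ 5 ∷ 0 ∷ []) ∷ [])) _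

op⋆-2^2-3-3 : OPstar (2 ∷ 2 ∷ 3 ∷ 3 ∷ [])
op⋆-2^2-3-3 = solution (2 ∷ 2 ∷ 3 ∷ 3 ∷ []) (orbit 9 1 9 ((9 ∷ 5 ∷ []) ∷ (2 ∷ 1 ∷ []) ∷ (6 ∷ 3 ∷ 8 ∷ []) ∷ (7 ∷ 0 ∷ 4 ∷ []) ∷ [])) _

op⋆-2^3-3-3 : OPstar (2 ∷ 2 ∷ 2 ∷ 3 ∷ 3 ∷ [])
op⋆-2^3-3-3 = solution (2 ∷ 2 ∷ 2 ∷ 3 ∷ 3 ∷ []) (orbit 11 1 11 ((11 ∷ 6 ∷ []) ∷ (4 ∷ 1 ∷ []) ∷ (9 ∷ 8 ∷ []) ∷ (0 ∷ 2 ∷ 7 ∷ []) ∷ (3 ∷ 10 ∷ 5 ∷ []) ∷ [])) _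

op⋆-2^4-3-3 : OPstar (2 ∷ 2 ∷ 2 ∷ 2 ∷ 3 ∷ 3 ∷ [])
op⋆-2^4-3-3 = solution (2 ∷ 2 ∷ 2 ∷ 2 ∷ 3 ∷ 3 ∷ []) (orbit 13 1 13 ((13 ∷ 8 ∷ []) ∷ (9 ∷ 1 ∷ []) ∷ (3 ∷ 7 ∷ []) ∷ (12 ∷ 6 ∷ []) ∷ (2 ∷ 5 ∷ 4 ∷ []) ∷ (10 ∷ 11 ∷ 0 ∷ []) ∷ [])) _

op⋆-2^5-3-3 : OPstar (2 ∷ 2 ∷ 2 ∷ 2 ∷ 2 ∷ 3 ∷ 3 ∷ [])
op⋆-2^5-3-3 = solution (2 ∷ 2 ∷ 2 ∷ 2 ∷ 2 ∷ 3 ∷ 3 ∷ []) (orbit 15 1 15 ((15 ∷ 14 ∷ []) ∷ (2 ∷ 8 ∷ []) ∷ (3 ∷ 5 ∷ []) ∷ (0 ∷ 11 ∷ []) ∷ (9 ∷ 10 ∷ []) ∷ (6 ∷ 13 ∷ 1 ∷ []) ∷ (7 ∷ 4 ∷ 12 ∷ []) ∷ [])) _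

op⋆-2^2-6 : OPstar (2 ∷ 2 ∷ 6 ∷ [])
op⋆-2^2-6 = solution (2 ∷ 2 ∷ 6 ∷ []) (orbit 9 1 9 ((9 ∷ 5 ∷ []) ∷ (2 ∷ 8 ∷ []) ∷ (1 ∷ 0 ∷ 7 ∷ 3 ∷ 4 ∷ 6 ∷ []) ∷ [])) _

op⋆-2^3-6 : OPstar (2 ∷ 2 ∷ 2 ∷ 6 ∷ [])
op⋆-2^3-6 = solution (2 ∷ 2 ∷ 2 ∷ 6 ∷ []) (orbit 11 1 11 ((11 ∷ 6 ∷ []) ∷ (4 ∷ 1 ∷ []) ∷ (5 ∷ 0 ∷ []) ∷ (9 ∷ 2 ∷ 3 ∷ 10 ∷ 8 ∷ 7 ∷ []) ∷ [])) _

op⋆-2^4-6 : OPstar (2 ∷ 2 ∷ 2 ∷ 2 ∷ 6 ∷ [])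
op⋆-2^4-6 = solution (2 ∷ 2 ∷ 2 ∷ 2 ∷ 6 ∷ []) (orbit 13 1 13 ((13 ∷ 8 ∷ []) ∷ (9 ∷ 1 ∷ []) ∷ (3 ∷ 2 ∷ []) ∷ (12 ∷ 5 ∷ []) ∷ (10 ∷ 6 ∷ 4 ∷ 7 ∷ 11 ∷ 0 ∷ []) ∷ [])) _

op⋆-2^b-3-3 : ∀ (b : ℕ) → 1 ≤ b → b ≤ 5 → OPstar (twos++ b (3 ∷ 3 ∷ []))
op⋆-2^b-3-3 0 () _
op⋆-2^b-3-3 1 _ _ = op⋆-2^1-3-3
op⋆-2^b-3-3 2 _ _ = op⋆-2^2-3-3
op⋆-2^b-3-3 3 _ _ = op⋆-2^3-3-3
op⋆-2^b-3-3 4 _ _ = op⋆-2^4-3-3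
op⋆-2^b-3-3 5 _ _ = op⋆-2^5-3-3
op⋆-2^b-3-3 (suc (suc (suc (suc (suc (suc _)))))) _ (s≤s (s≤s (s≤s (s≤s (s≤s ())))))

op⋆-2^b-6 : ∀ (b : ℕ) → 2 ≤ b → b ≤ 4 → OPstar (twos++ b (6 ∷ []))
op⋆-2^b-6 0 () _
op⋆-2^b-6 1 (s≤s ()) _
op⋆-2^b-6 2 _ _ = op⋆-2^2-6
op⋆-2^b-6 3 _ _ = op⋆-2^3-6
op⋆-2^b-6 4 _ _ = op⋆-2^4-6
op⋆-2^b-6 (suc (suc (suc (suc (suc _))))) _ (s≤s (s≤s (s≤s (s≤s ()))))

lemma3p3 : OPstar (4 ∷ 5 ∷ []) × OPstar (4 ∷ 6 ∷ []) × OPstar (2 ∷ 2 ∷ 2 ∷ 4 ∷ [])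
           × OPstar (4 ∷ 8 ∷ []) × OPstar (2 ∷ 4 ∷ 6 ∷ [])
           × (∀ (b : ℕ) → 1 ≤ b → b ≤ 5 → OPstar (twos++ b (3 ∷ 3 ∷ [])))
           × (∀ (b : ℕ) → 2 ≤ b → b ≤ 4 → OPstar (twos++ b (6 ∷ [])))
lemma3p3 = op⋆-4-5 , op⋆-4-6 , op⋆-2-2-2-4 , op⋆-4-8 , op⋆-2-4-6 , op⋆-2^b-3-3 , op⋆-2^b-6
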